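{- Let $m,n$ be positive integers and define $$S_3:=\sum_{a=1}^{m}\sum_{b=1}^{n}\binom{m+n+a-b-1}{m+a-1}\binom{m+n-a+b-1}{n+b-1}.$$ Then $$S_3=\frac{mn}{2(m+n)}\binom{m+n}{m}^2.$$
   Context: $\binom{N}{k}$ denotes the usual binomial coefficient, equal to $0$ when $k<0$ or $k>N$ for integers $N\ge 0$. -}

module Defs where

open import Data.Nat using (ℕ; zero; suc; _+_; _*_; _∸_)
open import Data.Nat.Combinatorics using (_C_)

ΣFrom1 : ℕ → (ℕ → ℕ) → ℕ
ΣFrom1 zero    f = 0
ΣFrom1 (suc n) f = ΣFrom1 n f + f (suc n)

-- For 1 ≤ a ≤ m, 1 ≤ b ≤ n, the tops m+n+a-b-1 ≥ m and m+n-a+b-1 ≥ n are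
-- nonnegative, so they are written with truncated subtraction as
-- (m+n+a) ∸ (b+1) and (m+n+b) ∸ (a+1), which is exact in this range.
S₃ : ℕ → ℕ → ℕ
S₃ m n = ΣFrom1 m λ a → ΣFrom1 n λ b →
  (((m + n + a) ∸ (b + 1)) C ((m + a) ∸ 1)) *
  (((m + n + b) ∸ (a + 1)) C ((n + b) ∸ 1))

{-# OPTIONS --safe #-}
module Submission where

-- With P(i, j) = C(i + j, i) the number of monotone lattice paths with i east and j north
-- steps, the summand of S₃ counts the paths from (0, 0) to (2m − 1, 2n − 1) through the point
-- (m + a − 1, n − b), so S₃ counts pairs (path, visited point of the block [m, 2m − 1] × [0, n − 1]).
-- Splitting every path at the north step by which it leaves that block and applying
-- Chu–Vandermonde twice collapses S₃ to  Σ_{c=1}^{m} c · P(m + c, n − 1) · P(m − c, n − 1).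
-- By the ratio P(x, r + 1) / P(x + 1, r) = (x + 1) / (r + 1) of neighbouring binomials,
-- 2c · P(m + c, n − 1) · P(m − c, n − 1) = n · (g(c) − g(c + 1)) with
-- g(c) = P(m + c − 1, n) · P(m − c, n) and g(m + 1) = 0, so the sum telescopes to 2 S₃ = n · g(1).

open import Defs
open import Data.Nat using (ℕ; zero; suc; _+_; _*_; _∸_; _≤_; _≥_)
open import Data.Nat.Properties
open import Data.Nat.Combinatorics using (_C_; nCn≡1; nCk+nC[k+1]≡[n+1]C[k+1])
open import Data.Nat.Tactic.RingSolver using (solve-∀)
open import Algebra.Properties.CommutativeSemigroup +-commutativeSemigroup using (interchange)
open import Relation.Binary.PropositionalEquality
open ≡-Reasoning

pascal : ℕ → ℕ → ℕ
pascal zero    j       = 1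
pascal (suc i) zero    = 1
pascal (suc i) (suc j) = pascal i (suc j) + pascal (suc i) j

pascal-zeroʳ : ∀ i → pascal i 0 ≡ 1
pascal-zeroʳ zero    = refl
pascal-zeroʳ (suc i) = refl

pascal-sym : ∀ i j → pascal i j ≡ pascal j i
pascal-sym zero    zero    = refl
pascal-sym zero    (suc j) = refl
pascal-sym (suc i) zero    = refl
pascal-sym (suc i) (suc j) = begin
  pascal i (suc j) + pascal (suc i) j ≡⟨ cong₂ _+_ (pascal-sym i (suc j)) (pascal-sym (suc i) j) ⟩
  pascal (suc j) i + pascal j (suc i) ≡⟨ +-comm (pascal (suc j) i) _ ⟩
  pascal j (suc i) + pascal (suc j) i ∎

pascal-C : ∀ i j → pascal i j ≡ (i + j) C i
pascal-C zero    j       = refl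
pascal-C (suc i) zero    = sym (trans (cong (_C suc i) (+-identityʳ (suc i))) (nCn≡1 (suc i)))
pascal-C (suc i) (suc j) = begin
  pascal i (suc j) + pascal (suc i) j          ≡⟨ cong₂ _+_ (pascal-C i (suc j)) (pascal-C (suc i) j) ⟩
  (i + suc j) C i + suc (i + j) C suc i        ≡⟨ cong (λ k → k C i + suc (i + j) C suc i) (+-suc i j) ⟩
  suc (i + j) C i + suc (i + j) C suc i        ≡⟨ nCk+nC[k+1]≡[n+1]C[k+1] (suc (i + j)) i ⟩
  suc (suc (i + j)) C suc i                    ≡⟨ cong (λ k → suc k C suc i) (+-suc i j) ⟨
  (suc i + suc j) C suc i                      ∎

pascal-oneˡ : ∀ j → pascal 1 j ≡ suc j
pascal-oneˡ zero    = refl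
pascal-oneˡ (suc j) = cong suc (pascal-oneˡ j)

pascal-ratio : ∀ i j → suc j * pascal i (suc j) ≡ suc i * pascal (suc i) j
pascal-ratio zero    j       = begin
  suc j * 1                  ≡⟨ *-identityʳ (suc j) ⟩
  suc j                      ≡⟨ pascal-oneˡ j ⟨
  pascal 1 j                 ≡⟨ *-identityˡ (pascal 1 j) ⟨
  1 * pascal 1 j             ∎
pascal-ratio (suc i) zero    = begin
  1 * pascal (suc i) 1       ≡⟨ *-identityˡ (pascal (suc i) 1) ⟩
  pascal (suc i) 1           ≡⟨ pascal-sym (suc i) 1 ⟩
  pascal 1 (suc i)           ≡⟨ pascal-oneˡ (suc i) ⟩
  suc (suc i)                ≡⟨ *-identityʳ (suc (suc i)) ⟨
  suc (suc i) * 1            ∎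
pascal-ratio (suc i) (suc j) = begin
  suc (suc j) * (a + b)                  ≡⟨ *-distribˡ-+ (suc (suc j)) a b ⟩
  suc (suc j) * a + (b + suc j * b)      ≡⟨ cong₂ (λ x y → x + (b + y)) (pascal-ratio i (suc j)) (pascal-ratio (suc i) j) ⟩
  suc i * b + (b + suc (suc i) * c)      ≡⟨ regroup (suc i) b c ⟩
  suc (suc i) * (b + c)                  ∎
  where
  a = pascal i (suc (suc j))
  b = pascal (suc i) (suc j)
  c = pascal (suc (suc i)) j
  regroup : ∀ x b c → x * b + (b + suc x * c) ≡ suc x * (b + c)
  regroup = solve-∀

pascal-absorption : ∀ i j → suc (i + j) * pascal i j ≡ suc i * pascal (suc i) j
pascal-absorption i zero    = begin
  suc (i + 0) * pascal i 0  ≡⟨ cong₂ (λ k p → suc k * p) (+-identityʳ i) (pascal-zeroʳ i) ⟩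
  suc i * 1                 ∎
pascal-absorption i (suc j) = begin
  (suc i + suc j) * a        ≡⟨ *-distribʳ-+ a (suc i) (suc j) ⟩
  suc i * a + suc j * a      ≡⟨ cong (suc i * a +_) (pascal-ratio i j) ⟩
  suc i * a + suc i * b      ≡⟨ *-distribˡ-+ (suc i) a b ⟨
  suc i * (a + b)            ∎
  where
  a = pascal i (suc j)
  b = pascal (suc i) j

antidiag : ℕ → (ℕ → ℕ → ℕ) → ℕ
antidiag zero    f = f 0 0
antidiag (suc p) f = antidiag p (λ i j → f i (suc j)) + f (suc p) 0

infix 5 antidiag
syntax antidiag p (λ i j → e) = ∑[ i + j ≡ p ] e

antidiag-cong : ∀ p {f g : ℕ → ℕ → ℕ} → (∀ i j → f i j ≡ g i j) → antidiag p f ≡ antidiag p g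
antidiag-cong zero    f≗g = f≗g 0 0
antidiag-cong (suc p) f≗g = cong₂ _+_ (antidiag-cong p (λ i j → f≗g i (suc j))) (f≗g (suc p) 0)

antidiag-+ : ∀ p (f g : ℕ → ℕ → ℕ) → (∑[ i + j ≡ p ] (f i j + g i j)) ≡ antidiag p f + antidiag p g
antidiag-+ zero    f g = refl
antidiag-+ (suc p) f g = begin
  (∑[ i + j ≡ p ] f i (suc j) + g i (suc j)) + (f (suc p) 0 + g (suc p) 0)
    ≡⟨ cong (_+ (f (suc p) 0 + g (suc p) 0)) (antidiag-+ p _ _) ⟩
  ((∑[ i + j ≡ p ] f i (suc j)) + (∑[ i + j ≡ p ] g i (suc j))) + (f (suc p) 0 + g (suc p) 0)
    ≡⟨ interchange (∑[ i + j ≡ p ] f i (suc j)) _ _ _ ⟩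
  ((∑[ i + j ≡ p ] f i (suc j)) + f (suc p) 0) + ((∑[ i + j ≡ p ] g i (suc j)) + g (suc p) 0) ∎

antidiag-*ˡ : ∀ p k (f : ℕ → ℕ → ℕ) → (∑[ i + j ≡ p ] (k * f i j)) ≡ k * antidiag p f
antidiag-*ˡ zero    k f = refl
antidiag-*ˡ (suc p) k f = begin
  (∑[ i + j ≡ p ] (k * f i (suc j))) + k * f (suc p) 0
    ≡⟨ cong (_+ k * f (suc p) 0) (antidiag-*ˡ p k _) ⟩
  k * (∑[ i + j ≡ p ] f i (suc j)) + k * f (suc p) 0
    ≡⟨ *-distribˡ-+ k _ _ ⟨
  k * ((∑[ i + j ≡ p ] f i (suc j)) + f (suc p) 0) ∎

antidiag-comm : ∀ p q (f : ℕ → ℕ → ℕ → ℕ → ℕ) →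
  (∑[ i + j ≡ p ] ∑[ k + l ≡ q ] f i j k l) ≡ (∑[ k + l ≡ q ] ∑[ i + j ≡ p ] f i j k l)
antidiag-comm zero    q f = refl
antidiag-comm (suc p) q f = begin
  (∑[ i + j ≡ p ] ∑[ k + l ≡ q ] f i (suc j) k l) + (∑[ k + l ≡ q ] f (suc p) 0 k l)
    ≡⟨ cong (_+ (∑[ k + l ≡ q ] f (suc p) 0 k l)) (antidiag-comm p q _) ⟩
  (∑[ k + l ≡ q ] ∑[ i + j ≡ p ] f i (suc j) k l) + (∑[ k + l ≡ q ] f (suc p) 0 k l)
    ≡⟨ antidiag-+ q _ _ ⟨
  (∑[ k + l ≡ q ] ((∑[ i + j ≡ p ] f i (suc j) k l) + f (suc p) 0 k l)) ∎

antidiag-assoc : ∀ p (f : ℕ → ℕ → ℕ → ℕ) →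
  (∑[ i + k ≡ p ] ∑[ c + d ≡ k ] f i c d) ≡ (∑[ e + d ≡ p ] ∑[ i + c ≡ e ] f i c d)
antidiag-assoc zero    f = refl
antidiag-assoc (suc p) f = begin
  (∑[ i + k ≡ p ] ((∑[ c + d ≡ k ] f i c (suc d)) + f i (suc k) 0)) + f (suc p) 0 0
    ≡⟨ cong (_+ f (suc p) 0 0) (antidiag-+ p _ _) ⟩
  ((∑[ i + k ≡ p ] ∑[ c + d ≡ k ] f i c (suc d)) + (∑[ i + k ≡ p ] f i (suc k) 0)) + f (suc p) 0 0
    ≡⟨ +-assoc (∑[ i + k ≡ p ] ∑[ c + d ≡ k ] f i c (suc d)) _ _ ⟩
  (∑[ i + k ≡ p ] ∑[ c + d ≡ k ] f i c (suc d)) + ((∑[ i + k ≡ p ] f i (suc k) 0) + f (suc p) 0 0)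
    ≡⟨ cong (_+ ((∑[ i + k ≡ p ] f i (suc k) 0) + f (suc p) 0 0)) (antidiag-assoc p _) ⟩
  (∑[ e + d ≡ p ] ∑[ i + c ≡ e ] f i c (suc d)) + (∑[ i + c ≡ suc p ] f i c 0) ∎

antidiag-constant : ∀ p (f : ℕ → ℕ → ℕ) c → (∀ i j → i + j ≡ p → f i j ≡ c) → antidiag p f ≡ suc p * c
antidiag-constant zero    f c f≡c = trans (f≡c 0 0 refl) (sym (+-identityʳ c))
antidiag-constant (suc p) f c f≡c = begin
  (∑[ i + j ≡ p ] f i (suc j)) + f (suc p) 0
    ≡⟨ cong₂ _+_ (antidiag-constant p _ c (λ i j i+j≡p → f≡c i (suc j) (trans (+-suc i j) (cong suc i+j≡p))))
                 (f≡c (suc p) 0 (+-identityʳ (suc p))) ⟩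
  suc p * c + c
    ≡⟨ +-comm (suc p * c) c ⟩
  suc (suc p) * c ∎

antidiag-telescope : ∀ p (f g : ℕ → ℕ → ℕ) →
  (∀ i j → i + j ≡ p → g i (suc j) ≡ f i j + g (suc i) j) →
  antidiag p f + g (suc p) 0 ≡ g 0 (suc p)
antidiag-telescope zero    f g step = sym (step 0 0 refl)
antidiag-telescope (suc p) f g step = begin
  ((∑[ i + j ≡ p ] f i (suc j)) + f (suc p) 0) + g (suc (suc p)) 0
    ≡⟨ +-assoc (∑[ i + j ≡ p ] f i (suc j)) _ _ ⟩
  (∑[ i + j ≡ p ] f i (suc j)) + (f (suc p) 0 + g (suc (suc p)) 0)
    ≡⟨ cong ((∑[ i + j ≡ p ] f i (suc j)) +_) (step (suc p) 0 (+-identityʳ (suc p))) ⟨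
  (∑[ i + j ≡ p ] f i (suc j)) + g (suc p) 1
    ≡⟨ antidiag-telescope p _ (λ i j → g i (suc j))
         (λ i j i+j≡p → step i (suc j) (trans (+-suc i j) (cong suc i+j≡p))) ⟩
  g 0 (suc (suc p)) ∎

ΣFrom1-cong : ∀ n {f g : ℕ → ℕ} → (∀ a → a ≤ n → f a ≡ g a) → ΣFrom1 n f ≡ ΣFrom1 n g
ΣFrom1-cong zero    f≗g = refl
ΣFrom1-cong (suc n) f≗g =
  cong₂ _+_ (ΣFrom1-cong n (λ a a≤n → f≗g a (m≤n⇒m≤1+n a≤n))) (f≗g (suc n) ≤-refl)

ΣFrom1-antidiag : ∀ k (f : ℕ → ℕ → ℕ) → ΣFrom1 (suc k) (λ a → f a (suc k ∸ a)) ≡ (∑[ i + j ≡ k ] f (suc i) j)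
ΣFrom1-antidiag zero    f = refl
ΣFrom1-antidiag (suc k) f = cong₂ _+_
  (trans (ΣFrom1-cong (suc k) (λ a a≤1+k → cong (f a) (+-∸-assoc 1 a≤1+k)))
         (ΣFrom1-antidiag k (λ a j → f a (suc j))))
  (cong (f (suc (suc k))) (n∸n≡0 k))

pascal-hockey-stick : ∀ p b → (∑[ i + j ≡ p ] pascal i b) ≡ pascal p (suc b)
pascal-hockey-stick zero    b = refl
pascal-hockey-stick (suc p) b = cong (_+ pascal (suc p) b) (pascal-hockey-stick p b)

vandermonde : ∀ p a b → (∑[ i + j ≡ p ] pascal i b * pascal j a) ≡ pascal p (suc (a + b))
vandermonde zero    a       b = refl
vandermonde (suc p) zero    b = begin
  (∑[ i + j ≡ suc p ] pascal i b * pascal j 0)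
    ≡⟨ antidiag-cong (suc p) {g = λ i j → pascal i b} (λ i j → trans (cong (pascal i b *_) (pascal-zeroʳ j)) (*-identityʳ _)) ⟩
  (∑[ i + j ≡ suc p ] pascal i b)
    ≡⟨ pascal-hockey-stick (suc p) b ⟩
  pascal (suc p) (suc b) ∎
vandermonde (suc p) (suc a) b = begin
  (∑[ i + j ≡ p ] pascal i b * (pascal j (suc a) + pascal (suc j) a)) + pascal (suc p) b * 1
    ≡⟨ cong (_+ pascal (suc p) b * 1) (antidiag-cong p (λ i j → *-distribˡ-+ (pascal i b) _ _)) ⟩
  (∑[ i + j ≡ p ] (pascal i b * pascal j (suc a) + pascal i b * pascal (suc j) a)) + pascal (suc p) b * 1
    ≡⟨ cong (_+ pascal (suc p) b * 1) (antidiag-+ p _ _) ⟩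
  ((∑[ i + j ≡ p ] pascal i b * pascal j (suc a)) + (∑[ i + j ≡ p ] pascal i b * pascal (suc j) a)) + pascal (suc p) b * 1
    ≡⟨ +-assoc (∑[ i + j ≡ p ] pascal i b * pascal j (suc a)) _ _ ⟩
  (∑[ i + j ≡ p ] pascal i b * pascal j (suc a)) + (∑[ i + j ≡ suc p ] pascal i b * pascal j a)
    ≡⟨ cong₂ _+_ (vandermonde p (suc a) b) (vandermonde (suc p) a b) ⟩
  pascal (suc p) (suc (suc a + b)) ∎

vandermonde′ : ∀ p a b → (∑[ i + j ≡ p ] pascal b i * pascal a j) ≡ pascal (suc (a + b)) p
vandermonde′ p a b = begin
  (∑[ i + j ≡ p ] pascal b i * pascal a j)  ≡⟨ antidiag-cong p (λ i j → cong₂ _*_ (pascal-sym b i) (pascal-sym a j)) ⟩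
  (∑[ i + j ≡ p ] pascal i b * pascal j a)  ≡⟨ vandermonde p a b ⟩
  pascal p (suc (a + b))                    ≡⟨ pascal-sym p _ ⟩
  pascal (suc (a + b)) p                    ∎

-- (r + 1) · (P(x, r + 1) P(y + 1, r + 1) − P(x + 1, r + 1) P(y, r + 1)) = (x − y) · P(x + 1, r) P(y + 1, r),
-- with x − y passed as k so that no subtraction occurs.
pascal-telescope-step : ∀ k x y r → suc x ≡ k + suc y →
  suc r * (pascal x (suc r) * pascal (suc y) (suc r)) ≡
  k * (pascal (suc x) r * pascal (suc y) r) + suc r * (pascal (suc x) (suc r) * pascal y (suc r))
pascal-telescope-step k x y r 1+x≡k+1+y = begin
  suc r * (A * (B + b))                            ≡⟨ expand (suc r) A B b ⟩
  suc r * (A * B) + (suc r * A) * b                ≡⟨ cong (λ t → suc r * (A * B) + t * b) (pascal-ratio x r) ⟩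
  suc r * (A * B) + (suc x * a) * b                ≡⟨ cong (λ t → suc r * (A * B) + (t * a) * b) 1+x≡k+1+y ⟩
  suc r * (A * B) + ((k + suc y) * a) * b          ≡⟨ split k (suc y) (suc r * (A * B)) a b ⟩
  k * (a * b) + suc r * (A * B) + a * (suc y * b)  ≡⟨ cong (λ t → k * (a * b) + suc r * (A * B) + a * t) (pascal-ratio y r) ⟨
  k * (a * b) + suc r * (A * B) + a * (suc r * B)  ≡⟨ collect k (suc r) A B a b ⟩
  k * (a * b) + suc r * ((A + a) * B)              ∎
  where
  A = pascal x (suc r)
  B = pascal y (suc r)
  a = pascal (suc x) r
  b = pascal (suc y) r
  expand : ∀ n A B b → n * (A * (B + b)) ≡ n * (A * B) + (n * A) * b
  expand = solve-∀
  split : ∀ k y c a b → c + ((k + y) * a) * b ≡ k * (a * b) + c + a * (y * b)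
  split = solve-∀
  collect : ∀ k n A B a b → k * (a * b) + n * (A * B) + a * (n * B) ≡ k * (a * b) + n * ((A + a) * B)
  collect = solve-∀

[1+p+q+x]∸[y+1]≡p+x+[q∸y] : ∀ p q x y → y ≤ q → (suc p + q + x) ∸ (y + 1) ≡ (p + x) + (q ∸ y)
[1+p+q+x]∸[y+1]≡p+x+[q∸y] p q x y y≤q = begin
  (suc p + q + x) ∸ (y + 1)  ≡⟨ cong ((suc p + q + x) ∸_) (+-comm y 1) ⟩
  (p + q + x) ∸ y            ≡⟨ cong (_∸ y) (swap-last p q x) ⟩
  ((p + x) + q) ∸ y          ≡⟨ +-∸-assoc (p + x) y≤q ⟩
  (p + x) + (q ∸ y)          ∎
  where
  swap-last : ∀ p q x → p + q + x ≡ (p + x) + q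
  swap-last = solve-∀

S₃-summand : ∀ m′ n′ a b → a ≤ suc m′ → b ≤ suc n′ →
  (((suc m′ + suc n′ + a) ∸ (b + 1)) C ((suc m′ + a) ∸ 1)) * (((suc m′ + suc n′ + b) ∸ (a + 1)) C ((suc n′ + b) ∸ 1))
    ≡ pascal (m′ + a) (suc n′ ∸ b) * pascal (suc m′ ∸ a) (n′ + b)
S₃-summand m′ n′ a b a≤m b≤n = cong₂ _*_
  (begin
    ((suc m′ + suc n′ + a) ∸ (b + 1)) C (m′ + a)   ≡⟨ cong (_C (m′ + a)) ([1+p+q+x]∸[y+1]≡p+x+[q∸y] m′ (suc n′) a b b≤n) ⟩
    ((m′ + a) + (suc n′ ∸ b)) C (m′ + a)          ≡⟨ pascal-C (m′ + a) (suc n′ ∸ b) ⟨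
    pascal (m′ + a) (suc n′ ∸ b)                  ∎)
  (begin
    ((suc m′ + suc n′ + b) ∸ (a + 1)) C (n′ + b)   ≡⟨ cong (λ t → ((t + b) ∸ (a + 1)) C (n′ + b)) (+-comm (suc m′) (suc n′)) ⟩
    ((suc n′ + suc m′ + b) ∸ (a + 1)) C (n′ + b)   ≡⟨ cong (_C (n′ + b)) ([1+p+q+x]∸[y+1]≡p+x+[q∸y] n′ (suc m′) b a a≤m) ⟩
    ((n′ + b) + (suc m′ ∸ a)) C (n′ + b)          ≡⟨ pascal-C (n′ + b) (suc m′ ∸ a) ⟨
    pascal (n′ + b) (suc m′ ∸ a)                  ≡⟨ pascal-sym (n′ + b) (suc m′ ∸ a) ⟩
    pascal (suc m′ ∸ a) (n′ + b)                  ∎)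

S₃-antidiag : ∀ m′ n′ →
  S₃ (suc m′) (suc n′) ≡ ∑[ i + i′ ≡ m′ ] ∑[ j′ + j ≡ n′ ] pascal (m′ + suc i) j * pascal i′ (n′ + suc j′)
S₃-antidiag m′ n′ = begin
  S₃ (suc m′) (suc n′)
    ≡⟨ ΣFrom1-cong (suc m′) (λ a a≤m →
         trans (ΣFrom1-cong (suc n′) (λ b b≤n → S₃-summand m′ n′ a b a≤m b≤n))
               (ΣFrom1-antidiag n′ (λ b j → pascal (m′ + a) j * pascal (suc m′ ∸ a) (n′ + b)))) ⟩
  ΣFrom1 (suc m′) (λ a → ∑[ j′ + j ≡ n′ ] pascal (m′ + a) j * pascal (suc m′ ∸ a) (n′ + suc j′))
    ≡⟨ ΣFrom1-antidiag m′ (λ a i′ → ∑[ j′ + j ≡ n′ ] pascal (m′ + a) j * pascal i′ (n′ + suc j′)) ⟩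
  (∑[ i + i′ ≡ m′ ] ∑[ j′ + j ≡ n′ ] pascal (m′ + suc i) j * pascal i′ (n′ + suc j′)) ∎

exit-decomposition : ∀ x i′ r →
  (∑[ j′ + j ≡ r ] pascal x j * pascal i′ (r + suc j′)) ≡ (∑[ c + d ≡ i′ ] pascal (suc (x + c)) r * pascal d r)
exit-decomposition x i′ r = begin
  (∑[ j′ + j ≡ r ] pascal x j * pascal i′ (r + suc j′))
    ≡⟨ antidiag-cong r (λ j′ j → cong (pascal x j *_) (trans (cong (pascal i′) (+-suc r j′)) (sym (vandermonde i′ r j′)))) ⟩
  (∑[ j′ + j ≡ r ] pascal x j * (∑[ c + d ≡ i′ ] pascal c j′ * pascal d r))
    ≡⟨ antidiag-cong r (λ j′ j → sym (antidiag-*ˡ i′ (pascal x j) _)) ⟩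
  (∑[ j′ + j ≡ r ] ∑[ c + d ≡ i′ ] pascal x j * (pascal c j′ * pascal d r))
    ≡⟨ antidiag-comm r i′ _ ⟩
  (∑[ c + d ≡ i′ ] ∑[ j′ + j ≡ r ] pascal x j * (pascal c j′ * pascal d r))
    ≡⟨ antidiag-cong i′ (λ c d → antidiag-cong r (λ j′ j → rotate (pascal x j) (pascal c j′) (pascal d r))) ⟩
  (∑[ c + d ≡ i′ ] ∑[ j′ + j ≡ r ] pascal d r * (pascal c j′ * pascal x j))
    ≡⟨ antidiag-cong i′ (λ c d → antidiag-*ˡ r (pascal d r) _) ⟩
  (∑[ c + d ≡ i′ ] pascal d r * (∑[ j′ + j ≡ r ] pascal c j′ * pascal x j))
    ≡⟨ antidiag-cong i′ (λ c d → trans (cong (pascal d r *_) (vandermonde′ r x c)) (*-comm (pascal d r) _)) ⟩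
  (∑[ c + d ≡ i′ ] pascal (suc (x + c)) r * pascal d r) ∎
  where
  rotate : ∀ a b c → a * (b * c) ≡ c * (b * a)
  rotate = solve-∀

S₃-single-sum : ∀ m′ n′ → S₃ (suc m′) (suc n′) ≡ ∑[ e + d ≡ m′ ] suc e * (pascal (suc (suc e + m′)) n′ * pascal d n′)
S₃-single-sum m′ n′ = begin
  S₃ (suc m′) (suc n′)
    ≡⟨ S₃-antidiag m′ n′ ⟩
  (∑[ i + i′ ≡ m′ ] ∑[ j′ + j ≡ n′ ] pascal (m′ + suc i) j * pascal i′ (n′ + suc j′))
    ≡⟨ antidiag-cong m′ (λ i i′ → exit-decomposition (m′ + suc i) i′ n′) ⟩
  (∑[ i + i′ ≡ m′ ] ∑[ c + d ≡ i′ ] pascal (suc (m′ + suc i + c)) n′ * pascal d n′)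
    ≡⟨ antidiag-assoc m′ _ ⟩
  (∑[ e + d ≡ m′ ] ∑[ i + c ≡ e ] pascal (suc (m′ + suc i + c)) n′ * pascal d n′)
    ≡⟨ antidiag-cong m′ (λ e d → antidiag-constant e _ _ (λ i c i+c≡e →
         cong (λ t → pascal (suc t) n′ * pascal d n′) (trans (shuffle m′ i c) (cong (λ s → suc s + m′) i+c≡e)))) ⟩
  (∑[ e + d ≡ m′ ] suc e * (pascal (suc (suc e + m′)) n′ * pascal d n′)) ∎
  where
  shuffle : ∀ m′ i c → m′ + suc i + c ≡ suc (i + c) + m′
  shuffle = solve-∀

-- For e + d = m − 1, tail (m − 1) (n − 1) e (d + 1) is n · g(e + 1) with g as in the header;
-- tail … 0 is the vanishing g(m + 1).
tail : ℕ → ℕ → ℕ → ℕ → ℕ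
tail m′ r e zero    = 0
tail m′ r e (suc d) = suc r * (pascal (suc (e + m′)) (suc r) * pascal d (suc r))

tail-step : ∀ r e d →
  tail (e + d) r e (suc d) ≡ 2 * (suc e * (pascal (suc (suc e + (e + d))) r * pascal d r)) + tail (e + d) r (suc e) d
tail-step r e zero    = begin
  suc r * (pascal x (suc r) * 1)    ≡⟨ cong (suc r *_) (*-identityʳ (pascal x (suc r))) ⟩
  suc r * pascal x (suc r)          ≡⟨ pascal-ratio x r ⟩
  suc x * pascal (suc x) r          ≡⟨ double e (pascal (suc x) r) ⟩
  2 * (suc e * (pascal (suc x) r * 1)) + 0 ∎
  where
  x = suc (e + (e + 0))
  double : ∀ e b → suc (suc (e + (e + 0))) * b ≡ 2 * (suc e * (b * 1)) + 0
  double = solve-∀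
tail-step r e (suc y) = trans
  (pascal-telescope-step (2 * suc e) x y r (arith e y))
  (cong (_+ tail (e + suc y) r (suc e) (suc y)) (*-assoc 2 (suc e) (pascal (suc x) r * pascal (suc y) r)))
  where
  x = suc (e + (e + suc y))
  arith : ∀ e y → suc (suc (e + (e + suc y))) ≡ 2 * suc e + suc y
  arith = solve-∀

two-S₃ : ∀ m′ n′ → 2 * S₃ (suc m′) (suc n′) ≡ suc n′ * (pascal (suc m′) (suc n′) * pascal m′ (suc n′))
two-S₃ m′ n′ = begin
  2 * S₃ (suc m′) (suc n′)                          ≡⟨ cong (2 *_) (S₃-single-sum m′ n′) ⟩
  2 * (∑[ e + d ≡ m′ ] suc e * T e d)               ≡⟨ antidiag-*ˡ m′ 2 _ ⟨
  (∑[ e + d ≡ m′ ] 2 * (suc e * T e d))             ≡⟨ +-identityʳ _ ⟨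
  (∑[ e + d ≡ m′ ] 2 * (suc e * T e d)) + 0         ≡⟨ antidiag-telescope m′ _ (tail m′ n′) step ⟩
  tail m′ n′ 0 (suc m′)                             ∎
  where
  T : ℕ → ℕ → ℕ
  T e d = pascal (suc (suc e + m′)) n′ * pascal d n′
  step : ∀ e d → e + d ≡ m′ → tail m′ n′ e (suc d) ≡ 2 * (suc e * T e d) + tail m′ n′ (suc e) d
  step e d refl = tail-step n′ e d

mainTheorem1 : (m n : ℕ) → m ≥ 1 → n ≥ 1 →
    2 * (m + n) * S₃ m n ≡ m * n * (((m + n) C m) * ((m + n) C m))
mainTheorem1 m@(suc m′) n@(suc n′) _ _ = begin
  2 * (m + n) * S₃ m n                ≡⟨ pull-2 (m + n) (S₃ m n) ⟩
  (m + n) * (2 * S₃ m n)              ≡⟨ cong ((m + n) *_) (two-S₃ m′ n′) ⟩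
  (m + n) * (n * (P * pascal m′ n))   ≡⟨ regroup (m + n) n P (pascal m′ n) ⟩
  n * P * ((m + n) * pascal m′ n)     ≡⟨ cong (n * P *_) (pascal-absorption m′ n) ⟩
  n * P * (m * P)                     ≡⟨ square m n P ⟩
  m * n * (P * P)                     ≡⟨ cong (λ t → m * n * (t * t)) (pascal-C m n) ⟩
  m * n * (((m + n) C m) * ((m + n) C m)) ∎
  where
  P = pascal m n
  pull-2 : ∀ a s → 2 * a * s ≡ a * (2 * s)
  pull-2 = solve-∀
  regroup : ∀ a n p q → a * (n * (p * q)) ≡ n * p * (a * q)
  regroup = solve-∀
  square : ∀ m n p → n * p * (m * p) ≡ m * n * (p * p)
  square = solve-∀
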